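{- Let $\langle I_n:n\in\omega\rangle$ be a sequence of $\sigma$-ideals over a set $X$ with $I_{n+1}\subset I_n$ for all $n$, and let $I=\bigcap_m I_m$. Suppose that for each $m$ there is a Galois–Tukey morphism from $\mathbf{Cof}(I_m)$ to $\mathbf{Lc}(\omega,2^{\mathrm{id}})$. Then there is a Galois–Tukey morphism from $\mathbf{Cof}(I)$ to $\mathbf{Lc}(\omega,2^{\mathrm{id}})$.
   Context: A relational system is a triple $(X,Y,R)$ with $R\subset X\times Y$. For relational systems $\mathcal{A}=(X,Y,R)$ and $\mathcal{B}=(X',Y',S)$, a Galois–Tukey morphism from $\mathcal{A}$ to $\mathcal{B}$ is a pair $(\varphi,\psi)$ with $\varphi\colon X\to X'$, $\psi\colon Y'\to Y$ such that for all $x\in X$, $y\in Y'$: $\varphi(x)\mathrel{S}y$ implies $x\mathrel{R}\psi(y)$. For an ideal $I$, $\mathbf{Cof}(I)=(I,I,\subset)$. $\mathbf{Lc}(\omega,2^{\mathrm{id}})=(\omega^\omega,S,\in^*)$, where $S=\prod_{n\in\omega}[\omega]^{\le 2^n}$ is the set of sequences $\langle S(n)\rangle$ of subsets of $\omega$ with $|S(n)|\le2^n$, and $x\in^*S$ iff $x(n)\in S(n)$ for all but finitely many $n$. -}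

module Defs where

open import Level using (Level; _⊔_; suc; zero)
open import Data.Nat using (ℕ; _≤_; _^_)
open import Data.List using (List; length)
open import Data.List.Membership.Propositional using (_∈_)
open import Data.Product using (Σ; ∃; _×_; _,_; proj₁)
open import Data.Empty using (⊥)

record RelSys (a b r : Level) : Set (Level.suc (a ⊔ b ⊔ r)) where
  field
    Dom : Set a
    Cod : Set b
    Rel : Dom → Cod → Set r

open RelSys public

GTMorphism : ∀ {a b r a' b' r'} → RelSys a b r → RelSys a' b' r' → Set (a ⊔ b ⊔ r ⊔ a' ⊔ b' ⊔ r')
GTMorphism 𝒜 ℬ =
  Σ (Dom 𝒜 → Dom ℬ) λ φ → Σ (Cod ℬ → Cod 𝒜) λ ψ →
    ∀ (x : Dom 𝒜) (y : Cod ℬ) → Rel ℬ (φ x) y → Rel 𝒜 x (ψ y)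

Subset : Set → Set₁
Subset X = X → Set

_⊆_ : {X : Set} → Subset X → Subset X → Set
A ⊆ B = ∀ x → A x → B x

∅ : {X : Set} → Subset X
∅ _ = ⊥

⋃ : {X : Set} → (ℕ → Subset X) → Subset X
⋃ A x = ∃ λ n → A n x

Family : Set → Set₁
Family X = Subset X → Set

record IsSigmaIdeal {X : Set} (I : Family X) : Set₁ where
  field
    ∅∈ : I ∅
    downward : ∀ (A B : Subset X) → A ⊆ B → I B → I A
    σ-union : ∀ (A : ℕ → Subset X) → (∀ n → I (A n)) → I (⋃ A)

Cof : {X : Set} → Family X → RelSys (Level.suc Level.zero) (Level.suc Level.zero) Level.zero
Cof {X} I = record
  { Dom = Σ (Subset X) I
  ; Cod = Σ (Subset X) I
  ; Rel = λ A B → proj₁ A ⊆ proj₁ B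
  }

Slalom : Set
Slalom = (n : ℕ) → Σ (List ℕ) λ l → length l ≤ 2 ^ n

_∈*_ : (ℕ → ℕ) → Slalom → Set
x ∈* S = ∃ λ N → ∀ n → N ≤ n → x n ∈ proj₁ (S n)

Lc-ω-2^id : RelSys Level.zero Level.zero Level.zero
Lc-ω-2^id = record { Dom = ℕ → ℕ ; Cod = Slalom ; Rel = _∈*_ }

⋂Fam : {X : Set} → (ℕ → Family X) → Family X
⋂Fam I A = ∀ m → I m A

{-# OPTIONS --safe #-}
-- Code the values φₘ(A)(n), m ≤ n, of the given morphisms into a single natural number
-- φ(A)(n). Decoding the m-th component of every entry of a slalom S yields a slalom Sₘ,
-- and φ(A) ∈* S implies φₘ(A) ∈* Sₘ, because the coded prefix contains φₘ(A)(n) once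
-- n ≥ m. Hence A ⊆ ψₘ(Sₘ) for every m, so ψ(S) := ⋂ₘ ψₘ(Sₘ) works: it lies in every Iₖ,
-- being a subset of ψₖ(Sₖ) ∈ Iₖ.
module Submission where

open import Defs
open import Data.Nat using (ℕ; suc; zero; _≤_; _<_; _⊔_; s≤s)
open import Data.Nat.Properties using (m≤m⊔n; m≤n⊔m; ≤-trans; ≤-reflexive)
open import Data.Nat.Binary using (ℕᵇ; 2[1+_]; 1+[2_]; toℕ; fromℕ) renaming (zero to 0ᵇ)
open import Data.Nat.Binary.Properties using (fromℕ-toℕ; toℕ-fromℕ)
open import Data.List using (map)
open import Data.List.Properties using (length-map)
open import Data.List.Membership.Propositional using (_∈_)
open import Data.List.Membership.Propositional.Properties using (∈-map⁺)
open import Data.Product using (Σ; _×_; _,_; proj₁; proj₂; map₁)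
open import Function using (_∘_)
open import Relation.Binary.PropositionalEquality using (_≡_; refl; cong; subst)

pairᵇ : ℕ → ℕᵇ → ℕᵇ
pairᵇ zero    b = 2[1+ b ]
pairᵇ (suc a) b = 1+[2 pairᵇ a b ]

unpairᵇ : ℕᵇ → ℕ × ℕᵇ
unpairᵇ 0ᵇ       = 0 , 0ᵇ
unpairᵇ 2[1+ x ] = 0 , x
unpairᵇ 1+[2 x ] = map₁ suc (unpairᵇ x)

unpairᵇ-pairᵇ : ∀ a b → unpairᵇ (pairᵇ a b) ≡ (a , b)
unpairᵇ-pairᵇ zero    b = refl
unpairᵇ-pairᵇ (suc a) b = cong (map₁ suc) (unpairᵇ-pairᵇ a b)

⟨_,_⟩ : ℕ → ℕ → ℕ
⟨ a , b ⟩ = toℕ (pairᵇ a (fromℕ b))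

π₁ π₂ : ℕ → ℕ
π₁ = proj₁ ∘ unpairᵇ ∘ fromℕ
π₂ = toℕ ∘ proj₂ ∘ unpairᵇ ∘ fromℕ

π₁-⟨,⟩ : ∀ a b → π₁ ⟨ a , b ⟩ ≡ a
π₁-⟨,⟩ a b rewrite fromℕ-toℕ (pairᵇ a (fromℕ b)) | unpairᵇ-pairᵇ a (fromℕ b) = refl

π₂-⟨,⟩ : ∀ a b → π₂ ⟨ a , b ⟩ ≡ b
π₂-⟨,⟩ a b rewrite fromℕ-toℕ (pairᵇ a (fromℕ b)) | unpairᵇ-pairᵇ a (fromℕ b) = toℕ-fromℕ b

encodePrefix : ℕ → (ℕ → ℕ) → ℕ
encodePrefix zero    f = 0
encodePrefix (suc n) f = ⟨ f 0 , encodePrefix n (f ∘ suc) ⟩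

lookupCode : ℕ → ℕ → ℕ
lookupCode zero    = π₁
lookupCode (suc m) = lookupCode m ∘ π₂

lookupCode-encodePrefix : ∀ {m n} f → m < n → lookupCode m (encodePrefix n f) ≡ f m
lookupCode-encodePrefix {zero}  {suc n} f _ = π₁-⟨,⟩ (f 0) (encodePrefix n (f ∘ suc))
lookupCode-encodePrefix {suc m} {suc n} f (s≤s m<n)
  rewrite π₂-⟨,⟩ (f 0) (encodePrefix n (f ∘ suc)) = lookupCode-encodePrefix (f ∘ suc) m<n

mapSlalom : (ℕ → ℕ) → Slalom → Slalom
mapSlalom g S n = map g (proj₁ (S n)) , ≤-trans (≤-reflexive (length-map g (proj₁ (S n)))) (proj₂ (S n))

∈*-map : ∀ g {x S} → x ∈* S → (g ∘ x) ∈* mapSlalom g S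
∈*-map g (N , x∈S) = N , λ n N≤n → ∈-map⁺ g (x∈S n N≤n)

∈*-eventually-≡ : ∀ {x y S} M → (∀ n → M ≤ n → x n ≡ y n) → x ∈* S → y ∈* S
∈*-eventually-≡ M x≡y (N , x∈S) = N ⊔ M , λ n N⊔M≤n →
  subst (_∈ _) (x≡y n (≤-trans (m≤n⊔m N M) N⊔M≤n)) (x∈S n (≤-trans (m≤m⊔n N M) N⊔M≤n))

⋂Fam-downward : ∀ {X} {I : ℕ → Family X} → (∀ k → IsSigmaIdeal (I k))
  → (B : Subset X) (C : ∀ k → Σ (Subset X) (I k)) → (∀ k → B ⊆ proj₁ (C k)) → ⋂Fam I B
⋂Fam-downward isI B C B⊆C k = IsSigmaIdeal.downward (isI k) B (proj₁ (C k)) (B⊆C k) (proj₂ (C k))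

mainTheorem6 : (X : Set) (I : ℕ → Family X)
    → (∀ n → IsSigmaIdeal (I n))
    → (∀ n (A : Subset X) → I (suc n) A → I n A)
    → (∀ m → GTMorphism (Cof (I m)) Lc-ω-2^id)
    → GTMorphism (Cof (⋂Fam I)) Lc-ω-2^id
mainTheorem6 X I isI _ morph = φ , ψ , φ∈*⇒⊆ψ
  where
  restrict : ∀ m → Σ (Subset X) (⋂Fam I) → Σ (Subset X) (I m)
  restrict m (A , A∈I) = A , A∈I m

  φ : Σ (Subset X) (⋂Fam I) → ℕ → ℕ
  φ A n = encodePrefix (suc n) λ m → proj₁ (morph m) (restrict m A) n

  ψₘ : ∀ m → Slalom → Σ (Subset X) (I m)
  ψₘ m S = proj₁ (proj₂ (morph m)) (mapSlalom (lookupCode m) S)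

  ψ : Slalom → Σ (Subset X) (⋂Fam I)
  ψ S = B , ⋂Fam-downward isI B (λ k → ψₘ k S) (λ k x x∈B → x∈B k)
    where
    B : Subset X
    B x = ∀ m → proj₁ (ψₘ m S) x

  φ∈*⇒⊆ψ : ∀ A S → φ A ∈* S → proj₁ A ⊆ proj₁ (ψ S)
  φ∈*⇒⊆ψ A S φA∈*S x x∈A m =
    proj₂ (proj₂ (morph m)) (restrict m A) (mapSlalom (lookupCode m) S) φₘA∈*Sₘ x x∈A
    where
    φₘA∈*Sₘ : proj₁ (morph m) (restrict m A) ∈* mapSlalom (lookupCode m) S
    φₘA∈*Sₘ = ∈*-eventually-≡ {S = mapSlalom (lookupCode m) S} m
      (λ n m≤n → lookupCode-encodePrefix (λ k → proj₁ (morph k) (restrict k A) n) (s≤s m≤n))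
      (∈*-map (lookupCode m) {S = S} φA∈*S)
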